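{- Let $G=(V,E)$ be a graph on $n$ vertices. Then $z(G;i)\leq z(G;i+1)$ for every integer $i$ with $1\leq i<\frac{n}{2}$.
   Context: Zero forcing: given a set of colored vertices of a graph, a colored vertex $u$ with exactly one uncolored neighbor $v$ may force $v$ to become colored. A set $S$ is a zero forcing set if starting with $S$ colored and repeatedly applying this rule colors all vertices. $z(G;i)$ is the number of zero forcing sets of $G$ of size $i$. -}

module Defs where

open import Data.Nat using (ℕ; zero; suc; _≤_)
open import Data.Bool using (Bool; true; false; _∧_; _∨_; not; if_then_else_)
open import Data.Fin using (Fin; _≟_)
open import Data.Fin.Subset using (Subset; ∣_∣)
open import Data.Vec using (Vec; []; _∷_; lookup; tabulate)
open import Data.List using (List; []; _∷_; _++_; map; filter; length; allFin)
open import Data.Bool.ListAction using (any; all)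
open import Relation.Nullary.Decidable using (⌊_⌋)
open import Relation.Binary.PropositionalEquality using (_≡_)
import Data.Nat as ℕ

record Graph (n : ℕ) : Set where
  field
    adj   : Fin n → Fin n → Bool
    sym   : ∀ u v → adj u v ≡ adj v u
    irrefl : ∀ v → adj v v ≡ false
open Graph public

forceStep : ∀ {n} → Graph n → Subset n → Subset n
forceStep {n} G S = tabulate λ v →
  lookup S v ∨
  any (λ u → lookup S u ∧ adj G u v ∧
        all (λ w → not (adj G u w) ∨ ⌊ w ≟ v ⌋ ∨ lookup S w) (allFin n))
      (allFin n)

iterate : ∀ {A : Set} → ℕ → (A → A) → A → A
iterate zero    f x = x
iterate (suc k) f x = iterate k f (f x)

-- Final colored set: forcing rounds applied n times (each productive round
-- colors at least one new vertex, so n rounds reach the closure).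
closure : ∀ {n} → Graph n → Subset n → Subset n
closure {n} G S = iterate n (forceStep G) S

isZeroForcing : ∀ {n} → Graph n → Subset n → Bool
isZeroForcing {n} G S = all (lookup (closure G S)) (allFin n)

allSubsets : (n : ℕ) → List (Subset n)
allSubsets zero    = [] ∷ []
allSubsets (suc n) = map (true ∷_) (allSubsets n) ++ map (false ∷_) (allSubsets n)

z : ∀ {n} → Graph n → ℕ → ℕ
z {n} G i = length (filter (λ S → ∣ S ∣ ℕ.≟ i) (filter (λ S → isZeroForcing G S Data.Bool.≟ true) (allSubsets n)))
  where import Data.Bool

module Submission where

-- Being a zero forcing set is an upward closed property:
-- forcing is monotone in the coloured set, so a superset of a zero forcing
-- set is again zero forcing.  For any upward closed family 𝓕 of subsets of
-- an n-element set, writing f_i for the number of members of size i, the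
-- "normalized matching" inequality
--     (n - i) · f_i  ≤  (i + 1) · f_(i+1)
-- holds (count pairs S ⊂ S ∪ {v} with S ∈ 𝓕 of size i; here it is proved
-- by induction on n, splitting the family by whether it contains the first
-- element).  When 2i < n we have i + 1 ≤ n - i, hence f_i ≤ f_(i+1).

open import Defs
open import Data.Nat using (ℕ; zero; suc; _+_; _∸_; _*_; _≤_; _<_; z≤n; s≤s)
import Data.Nat as ℕ
open import Data.Nat.Properties
open import Data.Bool using (Bool; true; false; _∧_; _∨_; not; if_then_else_; b≤b; f≤t)
  renaming (_≤_ to _≤ᵇ_)
import Data.Bool as Bool
open import Data.Bool.Properties using (≤-minimum; ≤-maximum; ∧-zeroʳ)
open import Data.Fin using (Fin)
import Data.Fin as Fin
open import Data.Fin.Subset using (Subset; ∣_∣)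
open import Data.Vec using (_∷_; lookup)
open import Data.Vec.Properties using (lookup∘tabulate)
open import Data.List using (List; []; _∷_; _++_; map; filter; length; allFin)
open import Data.Bool.ListAction using (any; all)
open import Relation.Nullary using (Dec; does)
open import Relation.Nullary.Decidable using (⌊_⌋)
open import Relation.Binary.PropositionalEquality using (_≡_; refl; cong; subst; module ≡-Reasoning)
open import Function using (_∘_)

∨-mono : ∀ {a a′ b b′} → a ≤ᵇ a′ → b ≤ᵇ b′ → (a ∨ b) ≤ᵇ (a′ ∨ b′)
∨-mono f≤t _ = ≤-maximum _
∨-mono {a = true}  b≤b _ = b≤b
∨-mono {a = false} b≤b q = q

∧-mono : ∀ {a a′ b b′} → a ≤ᵇ a′ → b ≤ᵇ b′ → (a ∧ b) ≤ᵇ (a′ ∧ b′)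
∧-mono f≤t _ = ≤-minimum _
∧-mono {a = true}  b≤b q = q
∧-mono {a = false} b≤b _ = b≤b

any-mono : ∀ {A : Set} {f g : A → Bool} → (∀ x → f x ≤ᵇ g x) →
           ∀ xs → any f xs ≤ᵇ any g xs
any-mono f≤g []       = b≤b
any-mono f≤g (x ∷ xs) = ∨-mono (f≤g x) (any-mono f≤g xs)

all-mono : ∀ {A : Set} {f g : A → Bool} → (∀ x → f x ≤ᵇ g x) →
           ∀ xs → all f xs ≤ᵇ all g xs
all-mono f≤g []       = b≤b
all-mono f≤g (x ∷ xs) = ∧-mono (f≤g x) (all-mono f≤g xs)

_⊑_ : ∀ {n} → Subset n → Subset n → Set
S ⊑ T = ∀ v → lookup S v ≤ᵇ lookup T v

forces : ∀ {n} → Graph n → Subset n → Fin n → Bool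
forces {n} G S v =
  lookup S v ∨
  any (λ u → lookup S u ∧ adj G u v ∧
        all (λ w → not (adj G u w) ∨ ⌊ w Fin.≟ v ⌋ ∨ lookup S w) (allFin n))
      (allFin n)

lookup-forceStep : ∀ {n} (G : Graph n) (S : Subset n) v →
                   lookup (forceStep G S) v ≡ forces G S v
lookup-forceStep G S = lookup∘tabulate (forces G S)

forces-mono : ∀ {n} (G : Graph n) (S T : Subset n) → S ⊑ T →
              ∀ v → forces G S v ≤ᵇ forces G T v
forces-mono {n} G S T S⊑T v =
  ∨-mono (S⊑T v)
    (any-mono (λ u → ∧-mono (S⊑T u) (∧-mono {adj G u v} b≤b
       (all-mono (λ w → ∨-mono {not (adj G u w)} b≤b
                          (∨-mono {⌊ w Fin.≟ v ⌋} b≤b (S⊑T w)))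
                 (allFin n))))
     (allFin n))

forceStep-mono : ∀ {n} (G : Graph n) (S T : Subset n) →
                 S ⊑ T → forceStep G S ⊑ forceStep G T
forceStep-mono G S T S⊑T v
  rewrite lookup-forceStep G S v | lookup-forceStep G T v = forces-mono G S T S⊑T v

iterate-mono : ∀ {n} (f : Subset n → Subset n) →
               (∀ S T → S ⊑ T → f S ⊑ f T) →
               ∀ k S T → S ⊑ T → iterate k f S ⊑ iterate k f T
iterate-mono f f-mono zero    S T S⊑T = S⊑T
iterate-mono f f-mono (suc k) S T S⊑T =
  iterate-mono f f-mono k (f S) (f T) (f-mono S T S⊑T)

UpClosed : ∀ {n} → (Subset n → Bool) → Set
UpClosed P = ∀ S T → S ⊑ T → P S ≤ᵇ P T

isZeroForcing-upClosed : ∀ {n} (G : Graph n) → UpClosed (isZeroForcing G)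
isZeroForcing-upClosed {n} G S T S⊑T =
  all-mono (iterate-mono (forceStep G) (forceStep-mono G) n S T S⊑T) (allFin n)

count : ∀ {A : Set} → (A → Bool) → List A → ℕ
count f []       = 0
count f (x ∷ xs) = if f x then suc (count f xs) else count f xs

count-++ : ∀ {A : Set} (f : A → Bool) xs ys →
           count f (xs ++ ys) ≡ count f xs + count f ys
count-++ f []       ys = refl
count-++ f (x ∷ xs) ys with f x
... | true  = cong suc (count-++ f xs ys)
... | false = count-++ f xs ys

count-map : ∀ {A B : Set} (f : B → Bool) (g : A → B) xs →
            count f (map g xs) ≡ count (f ∘ g) xs
count-map f g []       = refl
count-map f g (x ∷ xs) with f (g x)
... | true  = cong suc (count-map f g xs)
... | false = count-map f g xs

count-mono : ∀ {A : Set} {f g : A → Bool} → (∀ x → f x ≤ᵇ g x) →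
             ∀ xs → count f xs ≤ count g xs
count-mono f≤g [] = z≤n
count-mono {f = f} {g} f≤g (x ∷ xs) with f x | g x | f≤g x
... | true  | true  | _ = s≤s (count-mono f≤g xs)
... | false | true  | _ = m≤n⇒m≤1+n (count-mono f≤g xs)
... | false | false | _ = count-mono f≤g xs

count-cong : ∀ {A : Set} {f g : A → Bool} → (∀ x → f x ≡ g x) →
             ∀ xs → count f xs ≡ count g xs
count-cong f≡g [] = refl
count-cong {g = g} f≡g (x ∷ xs) rewrite f≡g x with g x
... | true  = cong suc (count-cong f≡g xs)
... | false = count-cong f≡g xs

count-none : ∀ {A : Set} {f : A → Bool} → (∀ x → f x ≡ false) →
             ∀ xs → count f xs ≡ 0
count-none f≡false []       = refl
count-none f≡false (x ∷ xs) rewrite f≡false x = count-none f≡false xs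

length-filter-filter :
  ∀ {A : Set} {P Q : A → Set} (P? : ∀ x → Dec (P x)) (Q? : ∀ x → Dec (Q x)) xs →
  length (filter Q? (filter P? xs)) ≡ count (λ x → does (P? x) ∧ does (Q? x)) xs
length-filter-filter P? Q? [] = refl
length-filter-filter P? Q? (x ∷ xs) with does (P? x)
... | false = length-filter-filter P? Q? xs
... | true with does (Q? x)
...   | true  = cong suc (length-filter-filter P? Q? xs)
...   | false = length-filter-filter P? Q? xs

level : ∀ n → (Subset n → Bool) → ℕ → ℕ
level n P i = count (λ S → P S ∧ does (∣ S ∣ ℕ.≟ i)) (allSubsets n)

with0 without0 : ∀ {n} → (Subset (suc n) → Bool) → Subset n → Bool
with0    P = P ∘ (true ∷_)
without0 P = P ∘ (false ∷_)

count-allSubsets-suc : ∀ n (f : Subset (suc n) → Bool) →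
  count f (allSubsets (suc n)) ≡ count (f ∘ (true ∷_)) (allSubsets n) + count (f ∘ (false ∷_)) (allSubsets n)
count-allSubsets-suc n f
  rewrite count-++ f (map (true ∷_) (allSubsets n)) (map (false ∷_) (allSubsets n))
        | count-map f (true ∷_) (allSubsets n)
        | count-map f (false ∷_) (allSubsets n) = refl

-- Sets of size i + 1 on n + 1 points: those containing 0 correspond to sets
-- of size i on the rest, the others to sets of size i + 1 on the rest.
level-suc : ∀ n (P : Subset (suc n) → Bool) i →
            level (suc n) P (suc i) ≡ level n (with0 P) i + level n (without0 P) (suc i)
level-suc n P i = count-allSubsets-suc n (λ S → P S ∧ does (∣ S ∣ ℕ.≟ suc i))

-- The empty set does not contain 0.
level-zero : ∀ n (P : Subset (suc n) → Bool) →
             level (suc n) P 0 ≡ level n (without0 P) 0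
level-zero n P
  rewrite count-allSubsets-suc n (λ S → P S ∧ does (∣ S ∣ ℕ.≟ 0))
        | count-none (λ S → ∧-zeroʳ (P (true ∷ S))) (allSubsets n) = refl

cons-⊑ : ∀ {n} b {S T : Subset n} → S ⊑ T → (b ∷ S) ⊑ (b ∷ T)
cons-⊑ b S⊑T Fin.zero    = b≤b
cons-⊑ b S⊑T (Fin.suc v) = S⊑T v

restrict-upClosed : ∀ {n} b (P : Subset (suc n) → Bool) →
                    UpClosed P → UpClosed (P ∘ (b ∷_))
restrict-upClosed b P up S T S⊑T = up (b ∷ S) (b ∷ T) (cons-⊑ b S⊑T)

-- Adding 0 to a set preserves P, so each level of without0 P is dominated
-- by the same level of with0 P.
without0≤with0 : ∀ {n} (P : Subset (suc n) → Bool) → UpClosed P →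
                 ∀ i → level n (without0 P) i ≤ level n (with0 P) i
without0≤with0 {n} P up i =
  count-mono (λ S → ∧-mono (up (false ∷ S) (true ∷ S) (add0 S)) b≤b) (allSubsets n)
  where
  add0 : ∀ S → (false ∷ S) ⊑ (true ∷ S)
  add0 S Fin.zero    = f≤t
  add0 S (Fin.suc v) = b≤b

-- The arithmetic of the induction step for levels i + 1 → i + 2, with
-- a₀ a₁ the levels i, i + 1 of with0 P, b₁ b₂ the levels i + 1, i + 2 of
-- without0 P, and d = n - i ≤ (n - (i + 1)) + 1 = d′ + 1.
matching-step : ∀ d d′ i a₀ a₁ b₁ b₂ →
  d * a₀ ≤ suc i * a₁ → d′ * b₁ ≤ suc (suc i) * b₂ → b₁ ≤ a₁ → d ≤ suc d′ →
  d * (a₀ + b₁) ≤ suc (suc i) * (a₁ + b₂)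
matching-step d d′ i a₀ a₁ b₁ b₂ ihA ihB b₁≤a₁ d≤d′+1 = begin
    d * (a₀ + b₁)
  ≡⟨ *-distribˡ-+ d a₀ b₁ ⟩
    d * a₀ + d * b₁
  ≤⟨ +-mono-≤ ihA (*-monoˡ-≤ b₁ d≤d′+1) ⟩
    suc i * a₁ + (b₁ + d′ * b₁)
  ≤⟨ +-monoʳ-≤ (suc i * a₁) (+-mono-≤ b₁≤a₁ ihB) ⟩
    suc i * a₁ + (a₁ + suc (suc i) * b₂)
  ≡⟨ +-assoc (suc i * a₁) a₁ _ ⟨
    suc i * a₁ + a₁ + suc (suc i) * b₂
  ≡⟨ cong (_+ suc (suc i) * b₂) (+-comm (suc i * a₁) a₁) ⟩
    suc (suc i) * a₁ + suc (suc i) * b₂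
  ≡⟨ *-distribˡ-+ (suc (suc i)) a₁ b₂ ⟨
    suc (suc i) * (a₁ + b₂)
  ∎
  where open ≤-Reasoning

-- The arithmetic of the base step for levels 0 → 1, with a₀ the level 0
-- of with0 P and b₀ b₁ the levels 0, 1 of without0 P.
matching-base : ∀ n a₀ b₀ b₁ → n * b₀ ≤ 1 * b₁ → b₀ ≤ a₀ →
                suc n * b₀ ≤ 1 * (a₀ + b₁)
matching-base n a₀ b₀ b₁ ih b₀≤a₀ rewrite *-identityˡ b₁ | *-identityˡ (a₀ + b₁) =
  +-mono-≤ b₀≤a₀ ih

upClosed-matching : ∀ n (P : Subset n → Bool) → UpClosed P →
                    ∀ i → (n ∸ i) * level n P i ≤ suc i * level n P (suc i)
upClosed-matching zero P up i rewrite 0∸n≡0 i = z≤n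
upClosed-matching (suc n) P up zero
  rewrite level-zero n P | level-suc n P 0 =
  matching-base n _ _ _
    (upClosed-matching n (without0 P) (restrict-upClosed false P up) 0)
    (without0≤with0 P up 0)
upClosed-matching (suc n) P up (suc i)
  rewrite level-suc n P i | level-suc n P (suc i) =
  matching-step (n ∸ i) (n ∸ suc i) i _ _ _ _
    (upClosed-matching n (with0 P) (restrict-upClosed true P up) i)
    (upClosed-matching n (without0 P) (restrict-upClosed false P up) (suc i))
    (without0≤with0 P up (suc i))
    (n∸i≤1+n∸[1+i] n i)
  where
  n∸i≤1+n∸[1+i] : ∀ m k → m ∸ k ≤ suc (m ∸ suc k)
  n∸i≤1+n∸[1+i] zero    zero    = z≤n
  n∸i≤1+n∸[1+i] zero    (suc k) = z≤n
  n∸i≤1+n∸[1+i] (suc m) zero    = ≤-refl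
  n∸i≤1+n∸[1+i] (suc m) (suc k) = n∸i≤1+n∸[1+i] m k

z≡level : ∀ {n} (G : Graph n) i → z G i ≡ level n (isZeroForcing G) i
z≡level {n} G i = begin
    z G i
  ≡⟨ length-filter-filter (λ S → isZeroForcing G S Bool.≟ true) (λ S → ∣ S ∣ ℕ.≟ i) (allSubsets n) ⟩
    count (λ S → does (isZeroForcing G S Bool.≟ true) ∧ does (∣ S ∣ ℕ.≟ i)) (allSubsets n)
  ≡⟨ count-cong (λ S → cong (_∧ does (∣ S ∣ ℕ.≟ i)) (does-≟-true (isZeroForcing G S))) (allSubsets n) ⟩
    level n (isZeroForcing G) i
  ∎
  where
  open ≡-Reasoning
  does-≟-true : ∀ b → does (b Bool.≟ true) ≡ b
  does-≟-true true  = refl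
  does-≟-true false = refl

-- By the
-- normalized matching inequality (n - i) · z(G;i) ≤ (i + 1) · z(G;i+1), and
-- 2i < n gives i + 1 ≤ n - i, so the factor i + 1 can be cancelled.
theorem5p4 : (n : ℕ) (G : Graph n) (i : ℕ) → 1 ≤ i → 2 * i < n → z G i ≤ z G (suc i)
theorem5p4 n G i _ 2i<n rewrite z≡level G i | z≡level G (suc i) =
  *-cancelˡ-≤ (suc i) (begin
    suc i * level n zf i    ≤⟨ *-monoˡ-≤ (level n zf i) 1+i≤n∸i ⟩
    (n ∸ i) * level n zf i  ≤⟨ upClosed-matching n zf (isZeroForcing-upClosed G) i ⟩
    suc i * level n zf (suc i) ∎)
  where
  open ≤-Reasoning
  zf : Subset n → Bool
  zf = isZeroForcing G
  1+i≤n∸i : suc i ≤ n ∸ i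
  1+i≤n∸i = m+n≤o⇒m≤o∸n (suc i) (subst (_≤ n) (cong (suc ∘ (i +_)) (+-identityʳ i)) 2i<n)
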